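{- Let $\delta,k\in\mathbb{Z}^+$ with $\delta>0$. Set $\alpha'=2^k/\delta+1$, $\varepsilon=\delta-2^k\%\delta$ and $N=\lceil\alpha'\cdot\varepsilon^{ -1}\rceil\cdot\delta-1$. If $\varepsilon\le\alpha'$, then $n/\delta=\alpha'\cdot n/2^k$ for all $n\in[0,N[$.
   Context: For $n,\delta\in\mathbb{Z}$ with $\delta\neq0$, $n/\delta$ and $n\%\delta$ denote the quotient and remainder of Euclidean division: the unique integers $q,s$ with $n=q\cdot\delta+s$ and $0\le s<|\delta|$. The operators $\cdot$, $/$, $\%$ have equal precedence and associate left to right (so $\alpha'\cdot n/2^k=(\alpha'\cdot n)/2^k$). $\alpha'\cdot\varepsilon^{ -1}$ is the rational number $\alpha'/\varepsilon$ and $\lceil\cdot\rceil$ is the ceiling. $\mathbb{Z}^+=\{x\in\mathbb{Z}: x\ge0\}$. For integers $a,b$, $[a,b[$ denotes $\{r\in\mathbb{Z}: a\le r<b\}$. -}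

module Defs where

open import Data.Nat using (ℕ; zero; suc; _+_; _*_; _∸_; _^_; NonZero)
open import Data.Nat.DivMod using (_/_; _%_)

-- ceiling of the rational a / b, for b > 0:  ⌈ a / b ⌉ = (a + (b - 1)) / b.
-- (The case b = 0 is never used below; it is given the junk value 0.)
ceilDiv : ℕ → ℕ → ℕ
ceilDiv a zero    = 0
ceilDiv a (suc b) = (a + b) / suc b

alpha' : (δ k : ℕ) → .{{_ : NonZero δ}} → ℕ
alpha' δ k = 2 ^ k / δ + 1

-- ε = δ - 2^k % δ   (always ≥ 1 since 2^k % δ < δ)
eps : (δ k : ℕ) → .{{_ : NonZero δ}} → ℕ
eps δ k = δ ∸ 2 ^ k % δ

-- N = ⌈ α' · ε⁻¹ ⌉ · δ - 1   (nonnegative since the ceiling is ≥ 1 and δ ≥ 1)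
bigN : (δ k : ℕ) → .{{_ : NonZero δ}} → ℕ
bigN δ k = ceilDiv (alpha' δ k) (eps δ k) * δ ∸ 1

open import Data.Nat.Properties using (m^n≢0)

divPow2 : ℕ → ℕ → ℕ
divPow2 a k = _/_ a (2 ^ k) {{m^n≢0 2 k}}

{-# OPTIONS --safe #-}
module Submission where

open import Defs
open import Data.Nat using (ℕ; _*_; _^_; _≤_; _<_; NonZero; suc; _+_; _∸_; s≤s; >-nonZero)
open import Data.Nat.DivMod using (_/_; _%_; m≡m%n+[m/n]*n; m%n<n; m/n*n≤m; m<n⇒m/n≡0; m*n/n≡m; +-distrib-/-∣ʳ; /-congˡ)
open import Data.Nat.Divisibility using (divides)
open import Data.Nat.Properties
open import Data.Nat.Tactic.RingSolver using (solve-∀)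
open import Data.Sum using (inj₁; inj₂)
open import Relation.Binary.PropositionalEquality using (_≡_; refl; sym; cong; cong₂; module ≡-Reasoning)

-- Write n = s + m δ and α δ = 2^k + ε. Then α n = (m ε + α s) + m 2^k, so α n / 2^k = m
-- exactly when m ε + α s < 2^k, i.e. when (m + 1) ε < α (δ - s). The hypothesis on n gives
-- m < c := ⌈α / ε⌉, and c ε < α + ε. If m + 1 < c this yields (m + 1) ε < α ≤ α (δ - s);
-- if m + 1 = c, the bound on n forces δ - s ≥ 2, and (m + 1) ε < α + ε ≤ 2 α by ε ≤ α.

[m+n*o]/o≡n : ∀ m n o .{{_ : NonZero o}} → m < o → (m + n * o) / o ≡ n
[m+n*o]/o≡n m n o m<o = begin
  (m + n * o) / o    ≡⟨ +-distrib-/-∣ʳ m (divides n refl) ⟩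
  m / o + n * o / o  ≡⟨ cong₂ _+_ (m<n⇒m/n≡0 m<o) (m*n/n≡m n o) ⟩
  n                  ∎
  where open ≡-Reasoning

[m/n+1]*n≡m+[n∸m%n] : ∀ m n .{{_ : NonZero n}} → (m / n + 1) * n ≡ m + (n ∸ m % n)
[m/n+1]*n≡m+[n∸m%n] m n = begin
  (q + 1) * n        ≡⟨ [a+1]*b≡a*b+b q n ⟩
  q * n + n          ≡⟨ cong (q * n +_) (sym (m+[n∸m]≡n (<⇒≤ (m%n<n m n)))) ⟩
  q * n + (r + ε)    ≡⟨ sym (+-assoc (q * n) r ε) ⟩
  q * n + r + ε      ≡⟨ cong (_+ ε) (+-comm (q * n) r) ⟩
  r + q * n + ε      ≡⟨ cong (_+ ε) (sym (m≡m%n+[m/n]*n m n)) ⟩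
  m + ε              ∎
  where
  open ≡-Reasoning
  q = m / n
  r = m % n
  ε = n ∸ r
  [a+1]*b≡a*b+b : ∀ a b → (a + 1) * b ≡ a * b + b
  [a+1]*b≡a*b+b = solve-∀

ceilDiv-*-< : ∀ a b .{{_ : NonZero b}} → ceilDiv a b * b < a + b
ceilDiv-*-< a (suc b) = ≤-<-trans (m/n*n≤m (a + b) (suc b)) (+-monoʳ-< a (n<1+n b))

m<n∸1⇒1+m<n : ∀ {m} n → m < n ∸ 1 → suc m < n
m<n∸1⇒1+m<n (suc n) m<n = s≤s m<n

*-/-exact : ∀ α {P δ ε} .{{_ : NonZero P}} .{{_ : NonZero δ}} → α * δ ≡ P + ε →
  ∀ n → suc (n / δ) * ε + α * (n % δ) < α * δ → α * n / P ≡ n / δ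
*-/-exact α {P} {δ} {ε} αδ≡P+ε n bound = begin
  α * n / P                    ≡⟨ /-congˡ α*n≡ ⟩
  (m * ε + α * s + m * P) / P  ≡⟨ [m+n*o]/o≡n (m * ε + α * s) m P remainder<P ⟩
  m                            ∎
  where
  open ≡-Reasoning
  m = n / δ
  s = n % δ
  distribute : ∀ a b c d → a * (b + c * d) ≡ a * b + c * (a * d)
  distribute = solve-∀
  regroup : ∀ a b c p e → a * b + c * (p + e) ≡ c * e + a * b + c * p
  regroup = solve-∀
  shift : ∀ a b e → a * e + b + e ≡ suc a * e + b
  shift = solve-∀
  α*n≡ : α * n ≡ m * ε + α * s + m * P
  α*n≡ = begin
    α * n                      ≡⟨ cong (α *_) (m≡m%n+[m/n]*n n δ) ⟩
    α * (s + m * δ)            ≡⟨ distribute α s m δ ⟩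
    α * s + m * (α * δ)        ≡⟨ cong (λ x → α * s + m * x) αδ≡P+ε ⟩
    α * s + m * (P + ε)        ≡⟨ regroup α s m P ε ⟩
    m * ε + α * s + m * P      ∎
  remainder<P : m * ε + α * s < P
  remainder<P = +-cancelʳ-< ε (m * ε + α * s) P
    (<-≤-trans (≤-<-trans (≤-reflexive (shift m (α * s) ε)) bound) (≤-reflexive αδ≡P+ε))

a<α*t⇒a+α*s<α*δ : ∀ α t {a s δ} → a < α * t → t + s ≤ δ → a + α * s < α * δ
a<α*t⇒a+α*s<α*δ α t {s = s} a<αt t+s≤δ = <-≤-trans (+-monoˡ-< (α * s) a<αt)
  (≤-trans (≤-reflexive (sym (*-distribˡ-+ α t s))) (*-monoʳ-≤ α t+s≤δ))

[1+m]*ε+α*s<α*δ : ∀ {α ε c δ} m s → ε ≤ α → c * ε < α + ε → s < δ →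
  suc (suc (s + m * δ)) ≤ c * δ → suc m * ε + α * s < α * δ
[1+m]*ε+α*s<α*δ {α} {ε} {c} {δ} m s ε≤α cε<α+ε s<δ 2+s+mδ≤cδ with m≤n⇒m<n∨m≡n m<c
  where
  m<c : m < c
  m<c = *-cancelʳ-< δ m c (≤-<-trans (m≤n+m (m * δ) s) (<-trans (n<1+n _) 2+s+mδ≤cδ))
... | inj₁ 1+m<c = a<α*t⇒a+α*s<α*δ α 1 1+mε<α*1 s<δ
  where
  1+mε<α*1 : suc m * ε < α * 1
  1+mε<α*1 rewrite *-identityʳ α = +-cancelʳ-< ε (suc m * ε) α
    (≤-<-trans (≤-reflexive (+-comm (suc m * ε) ε)) (≤-<-trans (*-monoˡ-≤ ε 1+m<c) cε<α+ε))
... | inj₂ refl = a<α*t⇒a+α*s<α*δ α 2 1+mε<α*2 (+-cancelʳ-≤ (m * δ) _ _ 2+s+mδ≤cδ)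
  where
  a+a≡a*2 : ∀ a → a + a ≡ a * 2
  a+a≡a*2 = solve-∀
  1+mε<α*2 : suc m * ε < α * 2
  1+mε<α*2 = <-≤-trans cε<α+ε (≤-trans (+-monoʳ-≤ α ε≤α) (≤-reflexive (a+a≡a*2 α)))

theorem4 : (δ k : ℕ) → .{{_ : NonZero δ}} →
    eps δ k ≤ alpha' δ k →
    (n : ℕ) → n < bigN δ k →
    n / δ ≡ divPow2 (alpha' δ k * n) k
theorem4 δ k ε≤α n n<N = sym (*-/-exact α {{m^n≢0 2 k}} αδ≡2^k+ε n bound)
  where
  α = alpha' δ k
  ε = eps δ k
  c = ceilDiv α ε
  instance
    ε≢0 : NonZero ε
    ε≢0 = >-nonZero (m<n⇒0<n∸m (m%n<n (2 ^ k) δ))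
  αδ≡2^k+ε : α * δ ≡ 2 ^ k + ε
  αδ≡2^k+ε = [m/n+1]*n≡m+[n∸m%n] (2 ^ k) δ
  2+s+mδ≤cδ : suc (suc (n % δ + n / δ * δ)) ≤ c * δ
  2+s+mδ≤cδ rewrite sym (m≡m%n+[m/n]*n n δ) = m<n∸1⇒1+m<n (c * δ) n<N
  bound : suc (n / δ) * ε + α * (n % δ) < α * δ
  bound = [1+m]*ε+α*s<α*δ {c = c} (n / δ) (n % δ) ε≤α (ceilDiv-*-< α ε) (m%n<n n δ) 2+s+mδ≤cδ
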